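{- Let $\Phi$ be an infinite set of propositional variables. For every formula $\varphi\in\mathrm{EMDL}(\Phi)$ there exists a formula $\varphi^*\in\mathrm{MDL}(\Phi)$ such that for every Kripke frame $\mathfrak{F}$: $\mathfrak{F}\models\varphi$ if and only if $\mathfrak{F}\models\varphi^*$.
   Context: $\mathrm{ML}(\Phi)$: $\varphi ::= p \mid \neg p \mid (\varphi\wedge\varphi)\mid(\varphi\vee\varphi)\mid\Diamond\varphi\mid\Box\varphi$, $p\in\Phi$. $\mathrm{EMDL}(\Phi)$ extends this by dependence atoms $=\!(\varphi_1,\dots,\varphi_n,\psi)$ ($n\ge0$) with $\varphi_1,\dots,\varphi_n,\psi\in\mathrm{ML}(\Phi)$; $\mathrm{MDL}(\Phi)$ allows such atoms only with $\varphi_1,\dots,\varphi_n,\psi\in\Phi$. Team semantics for a model $(W,R,V)$ and $T\subseteq W$: $T\models p$ iff $T\subseteq V(p)$; $T\models\neg p$ iff $T\cap V(p)=\emptyset$; $\wedge$ conjunction; $T\models\varphi\vee\psi$ iff $T=T_1\cup T_2$ with $T_1\models\varphi$, $T_2\models\psi$; $T\models\Diamond\varphi$ iff $T'\models\varphi$ for some $T'$ with every point of $T$ having an $R$-successor in $T'$ and every point of $T'$ an $R$-predecessor in $T$; $T\models\Box\varphi$ iff $R[T]\models\varphi$ ($R[T]$ = set of $R$-successors of points of $T$); $T\models=\!(\varphi_1,\dots,\varphi_n,\psi)$ iff any $w,v\in T$ agreeing on the truth at $\{w\}$, $\{v\}$ of all $\varphi_i$ also agree on $\psi$. $\mathfrak{F}\models\varphi$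 means: for every valuation $V$ and every team $T$ of $(\mathfrak{F},V)$, $(\mathfrak{F},V),T\models\varphi$. -}

module Defs where

open import Level using (Lift)
open import Data.Empty using (⊥)
open import Data.Unit using (⊤)
open import Data.List using (List)
open import Data.List.Membership.Propositional using (_∉_)
open import Data.List.Relation.Unary.All using (All)
open import Data.Product using (Σ; _×_; ∃)
open import Data.Sum using (_⊎_)
open import Relation.Nullary using (¬_)
open import Relation.Binary.PropositionalEquality using (_≡_)
open import Function.Bundles using (_⇔_)

Infinite : Set → Set
Infinite Φ = (xs : List Φ) → ∃ λ p → p ∉ xs

data ML (Φ : Set) : Set where
  var  : Φ → ML Φ
  nvar : Φ → ML Φ
  _∧_  : ML Φ → ML Φ → ML Φ
  _∨_  : ML Φ → ML Φ → ML Φ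
  ◇    : ML Φ → ML Φ
  □    : ML Φ → ML Φ

data EMDL (Φ : Set) : Set where
  var  : Φ → EMDL Φ
  nvar : Φ → EMDL Φ
  _∧_  : EMDL Φ → EMDL Φ → EMDL Φ
  _∨_  : EMDL Φ → EMDL Φ → EMDL Φ
  ◇    : EMDL Φ → EMDL Φ
  □    : EMDL Φ → EMDL Φ
  dep  : List (ML Φ) → ML Φ → EMDL Φ

data IsVar {Φ : Set} : ML Φ → Set where
  isVar : (p : Φ) → IsVar (var p)

-- MDL(Φ) as the fragment of EMDL(Φ) whose dependence atoms only contain variables
data IsMDL {Φ : Set} : EMDL Φ → Set where
  var  : (p : Φ) → IsMDL (var p)
  nvar : (p : Φ) → IsMDL (nvar p)
  _∧_  : {φ ψ : EMDL Φ} → IsMDL φ → IsMDL ψ → IsMDL (φ ∧ ψ)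
  _∨_  : {φ ψ : EMDL Φ} → IsMDL φ → IsMDL ψ → IsMDL (φ ∨ ψ)
  ◇    : {φ : EMDL Φ} → IsMDL φ → IsMDL (◇ φ)
  □    : {φ : EMDL Φ} → IsMDL φ → IsMDL (□ φ)
  dep  : {φs : List (ML Φ)} {ψ : ML Φ} → All IsVar φs → IsVar ψ → IsMDL (dep φs ψ)

record Frame : Set₁ where
  field
    W : Set
    R : W → W → Set

module _ {Φ : Set} (F : Frame) where
  open Frame F

  Valuation : Set₁
  Valuation = Φ → W → Set

  Team : Set₁
  Team = W → Set

  ⟦_⟧ : W → Team
  ⟦ w ⟧ v = w ≡ v

  IsUnion : Team → Team → Team → Set
  IsUnion T T₁ T₂ = (∀ w → T w → T₁ w ⊎ T₂ w) × (∀ w → T₁ w → T w) × (∀ w → T₂ w → T w)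

  Succ : Team → Team → Set
  Succ T T' = (∀ w → T w → Σ W λ v → R w v × T' v) × (∀ v → T' v → Σ W λ w → T w × R w v)

  Img : Team → Team
  Img T v = Σ W λ w → T w × R w v

  _,_⊨ᴹ_ : Valuation → Team → ML Φ → Set₁
  V , T ⊨ᴹ var p   = Lift _ (∀ w → T w → V p w)
  V , T ⊨ᴹ nvar p  = Lift _ (∀ w → T w → ¬ V p w)
  V , T ⊨ᴹ (φ ∧ ψ) = (V , T ⊨ᴹ φ) × (V , T ⊨ᴹ ψ)
  V , T ⊨ᴹ (φ ∨ ψ) = Σ Team λ T₁ → Σ Team λ T₂ →
                       IsUnion T T₁ T₂ × (V , T₁ ⊨ᴹ φ) × (V , T₂ ⊨ᴹ ψ)
  V , T ⊨ᴹ ◇ φ     = Σ Team λ T' → Succ T T' × (V , T' ⊨ᴹ φ)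
  V , T ⊨ᴹ □ φ     = V , Img T ⊨ᴹ φ

  Agree : Valuation → W → W → ML Φ → Set₁
  Agree V w v φ = (V , ⟦ w ⟧ ⊨ᴹ φ) ⇔ (V , ⟦ v ⟧ ⊨ᴹ φ)

  _,_⊨_ : Valuation → Team → EMDL Φ → Set₁
  V , T ⊨ var p   = Lift _ (∀ w → T w → V p w)
  V , T ⊨ nvar p  = Lift _ (∀ w → T w → ¬ V p w)
  V , T ⊨ (φ ∧ ψ) = (V , T ⊨ φ) × (V , T ⊨ ψ)
  V , T ⊨ (φ ∨ ψ) = Σ Team λ T₁ → Σ Team λ T₂ →
                      IsUnion T T₁ T₂ × (V , T₁ ⊨ φ) × (V , T₂ ⊨ ψ)
  V , T ⊨ ◇ φ     = Σ Team λ T' → Succ T T' × (V , T' ⊨ φ)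
  V , T ⊨ □ φ     = V , Img T ⊨ φ
  V , T ⊨ dep φs ψ = ∀ w v → T w → T v →
                      All (Agree V w v) φs → Agree V w v ψ

_⊨F_ : {Φ : Set} → Frame → EMDL Φ → Set₁
F ⊨F φ = ∀ V T → _,_⊨_ F V T φ

-- An extended dependence atom =(δ₁,…,δₙ,δ₀) is replaced by (⋁ᵢ qᵢ ≠ δᵢ) ∨ =(q₁,…,qₙ,q₀)
-- for fresh variables qᵢ, where qᵢ ≠ δᵢ is the flat formula (qᵢ ∧ ¬δᵢ) ∨ (¬qᵢ ∧ δᵢ).
-- Under every valuation the atom implies its replacement: split the team into the points
-- where each qᵢ agrees with δᵢ, which satisfy =(q₁,…,qₙ,q₀), and the remaining points,
-- which satisfy the flat disjunction (this split uses excluded middle). Conversely, if the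
-- translation is valid on a frame, evaluate it under the valuation reading each qᵢ as δᵢ:
-- there no point satisfies ⋁ᵢ qᵢ ≠ δᵢ, so the whole team satisfies =(q₁,…,qₙ,q₀), which then
-- says =(δ₁,…,δₙ,δ₀). Infinitely many variables guarantee enough fresh ones.
module Submission where

open import Defs
open import Level using (0ℓ; lift; lower)
open import Axiom.ExcludedMiddle using (ExcludedMiddle)
open import Data.Empty using (⊥)
open import Data.Unit using (⊤; tt)
open import Data.List using (List; []; _∷_; _++_; length; concatMap)
open import Data.List.Membership.Propositional using (_∈_; _∉_)
open import Data.List.Membership.Propositional.Properties using (∈-++⁺ˡ; ∈-++⁺ʳ)
open import Data.List.Relation.Unary.All using (All; []; _∷_; tabulate)
open import Data.List.Relation.Unary.All.Properties using (++⁻ˡ; ++⁻ʳ; concat⁻; map⁻)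
open import Data.List.Relation.Unary.Any using (here; there)
open import Data.Nat using (ℕ; _+_; _<_)
open import Data.Nat.Properties using (<-cmp; m<1+n⇒m<n∨m≡n)
open import Data.Product using (Σ; _×_; _,_; proj₁; proj₂)
open import Data.Product.Function.NonDependent.Propositional using (_×-⇔_)
open import Data.Sum using (_⊎_; inj₁; inj₂)
open import Data.Sum.Function.Propositional using (_⊎-⇔_)
open import Function using (_∘_)
open import Function.Bundles using (_⇔_; mk⇔; module Equivalence)
open import Function.Construct.Composition using (_⇔-∘_)
open import Function.Construct.Symmetry using (⇔-sym)
open import Function.Definitions using (Injective)
open import Function.Related.TypeIsomorphisms using (¬-cong-⇔)
open import Relation.Binary.Definitions using (tri<; tri≈; tri>)
open import Relation.Binary.PropositionalEquality using (_≡_; _≢_; refl; sym; subst)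
open import Relation.Nullary using (¬_; yes; no; contradiction)
open import Relation.Nullary.Decidable using (map′; decidable-stable)
open Equivalence using (to; from)

⇔-cong : ∀ {a a′ b b′} {A : Set a} {A′ : Set a′} {B : Set b} {B′ : Set b′} →
         A ⇔ A′ → B ⇔ B′ → (A ⇔ B) ⇔ (A′ ⇔ B′)
⇔-cong A⇔A′ B⇔B′ =
  mk⇔ (λ A⇔B → B⇔B′ ⇔-∘ (A⇔B ⇔-∘ ⇔-sym A⇔A′))
      (λ A′⇔B′ → ⇔-sym B⇔B′ ⇔-∘ (A′⇔B′ ⇔-∘ A⇔A′))

module FreshSequence {Φ : Set} (inf : Infinite Φ) (L : List Φ) where
  open import Data.Nat using (zero; suc)

  mutual
    prefix : ℕ → List Φ
    prefix zero    = []
    prefix (suc n) = fresh n ∷ prefix n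

    fresh : ℕ → Φ
    fresh n = proj₁ (inf (prefix n ++ L))

  fresh-∉-prefix++L : ∀ n → fresh n ∉ prefix n ++ L
  fresh-∉-prefix++L n = proj₂ (inf (prefix n ++ L))

  fresh-∉ : ∀ n → fresh n ∉ L
  fresh-∉ n = fresh-∉-prefix++L n ∘ ∈-++⁺ʳ (prefix n)

  fresh-∈-prefix : ∀ {m n} → m < n → fresh m ∈ prefix n
  fresh-∈-prefix {m} {suc n} m<1+n with m<1+n⇒m<n∨m≡n m<1+n
  ... | inj₁ m<n = there (fresh-∈-prefix m<n)
  ... | inj₂ refl = here refl

  fresh-≢ : ∀ {m n} → m < n → fresh m ≢ fresh n
  fresh-≢ {n = n} m<n eq =
    fresh-∉-prefix++L n (∈-++⁺ˡ (subst (_∈ prefix n) eq (fresh-∈-prefix m<n)))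

  fresh-injective : Injective _≡_ _≡_ fresh
  fresh-injective {m} {n} eq with <-cmp m n
  ... | tri< m<n _ _ = contradiction eq (fresh-≢ m<n)
  ... | tri≈ _ m≡n _ = m≡n
  ... | tri> _ _ n<m = contradiction (sym eq) (fresh-≢ n<m)

fresh-sequence : {Φ : Set} → Infinite Φ → (L : List Φ) →
                 Σ (ℕ → Φ) λ s → Injective _≡_ _≡_ s × (∀ i → s i ∉ L)
fresh-sequence inf L = fresh , fresh-injective , fresh-∉
  where open FreshSequence inf L

module Syntax {Φ : Set} where
  open import Data.Nat using (suc)

  toEMDL : ML Φ → EMDL Φ
  toEMDL (var p)  = var p
  toEMDL (nvar p) = nvar p
  toEMDL (δ ∧ ε)  = toEMDL δ ∧ toEMDL ε
  toEMDL (δ ∨ ε)  = toEMDL δ ∨ toEMDL ε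
  toEMDL (◇ δ)    = ◇ (toEMDL δ)
  toEMDL (□ δ)    = □ (toEMDL δ)

  negate : ML Φ → ML Φ
  negate (var p)  = nvar p
  negate (nvar p) = var p
  negate (δ ∧ ε)  = negate δ ∨ negate ε
  negate (δ ∨ ε)  = negate δ ∧ negate ε
  negate (◇ δ)    = □ (negate δ)
  negate (□ δ)    = ◇ (negate δ)

  mismatch : Φ → ML Φ → ML Φ
  mismatch q δ = (var q ∧ negate δ) ∨ (nvar q ∧ δ)

  someMismatch : (ℕ → Φ) → ML Φ → List (ML Φ) → ML Φ
  someMismatch s δ []       = mismatch (s 0) δ
  someMismatch s δ (ε ∷ εs) = mismatch (s 0) δ ∨ someMismatch (s ∘ suc) ε εs

  labels : (ℕ → Φ) → List (ML Φ) → List (ML Φ)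
  labels s []       = []
  labels s (_ ∷ δs) = var (s 0) ∷ labels (s ∘ suc) δs

  depArgs : EMDL Φ → List (ML Φ)
  depArgs (var p)    = []
  depArgs (nvar p)   = []
  depArgs (φ ∧ ψ)    = depArgs φ ++ depArgs ψ
  depArgs (φ ∨ ψ)    = depArgs φ ++ depArgs ψ
  depArgs (◇ φ)      = depArgs φ
  depArgs (□ φ)      = depArgs φ
  depArgs (dep δs δ) = δ ∷ δs

  -- The i-th formula of depArgs φ is labelled by the variable s i.
  translate : EMDL Φ → (ℕ → Φ) → EMDL Φ
  translate (var p)    s = var p
  translate (nvar p)   s = nvar p
  translate (φ ∧ ψ)    s = translate φ s ∧ translate ψ (s ∘ (length (depArgs φ) +_))
  translate (φ ∨ ψ)    s = translate φ s ∨ translate ψ (s ∘ (length (depArgs φ) +_))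
  translate (◇ φ)      s = ◇ (translate φ s)
  translate (□ φ)      s = □ (translate φ s)
  translate (dep δs δ) s = toEMDL (someMismatch s δ δs) ∨ dep (labels (s ∘ suc) δs) (var (s 0))

  isMDL-toEMDL : ∀ δ → IsMDL (toEMDL δ)
  isMDL-toEMDL (var p)  = var p
  isMDL-toEMDL (nvar p) = nvar p
  isMDL-toEMDL (δ ∧ ε)  = isMDL-toEMDL δ ∧ isMDL-toEMDL ε
  isMDL-toEMDL (δ ∨ ε)  = isMDL-toEMDL δ ∨ isMDL-toEMDL ε
  isMDL-toEMDL (◇ δ)    = ◇ (isMDL-toEMDL δ)
  isMDL-toEMDL (□ δ)    = □ (isMDL-toEMDL δ)

  labels-areVars : ∀ s δs → All IsVar (labels s δs)
  labels-areVars s []       = []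
  labels-areVars s (_ ∷ δs) = isVar (s 0) ∷ labels-areVars (s ∘ suc) δs

  isMDL-translate : ∀ φ s → IsMDL (translate φ s)
  isMDL-translate (var p)    s = var p
  isMDL-translate (nvar p)   s = nvar p
  isMDL-translate (φ ∧ ψ)    s = isMDL-translate φ s ∧ isMDL-translate ψ _
  isMDL-translate (φ ∨ ψ)    s = isMDL-translate φ s ∨ isMDL-translate ψ _
  isMDL-translate (◇ φ)      s = ◇ (isMDL-translate φ s)
  isMDL-translate (□ φ)      s = □ (isMDL-translate φ s)
  isMDL-translate (dep δs δ) s =
    isMDL-toEMDL (someMismatch s δ δs) ∨ dep (labels-areVars (s ∘ suc) δs) (isVar (s 0))

  varsᴹ : ML Φ → List Φ
  varsᴹ (var p)  = p ∷ []
  varsᴹ (nvar p) = p ∷ []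
  varsᴹ (δ ∧ ε)  = varsᴹ δ ++ varsᴹ ε
  varsᴹ (δ ∨ ε)  = varsᴹ δ ++ varsᴹ ε
  varsᴹ (◇ δ)    = varsᴹ δ
  varsᴹ (□ δ)    = varsᴹ δ

  vars : EMDL Φ → List Φ
  vars (var p)    = p ∷ []
  vars (nvar p)   = p ∷ []
  vars (φ ∧ ψ)    = vars φ ++ vars ψ
  vars (φ ∨ ψ)    = vars φ ++ vars ψ
  vars (◇ φ)      = vars φ
  vars (□ φ)      = vars φ
  vars (dep δs δ) = concatMap varsᴹ (δ ∷ δs)

module Semantics {Φ : Set} (F : Frame) where
  open import Data.Nat using (suc)
  open Frame F
  open Syntax {Φ}

  Val : Set₁
  Val = Valuation {Φ} F

  infix 4 _∣_⊨ᴹ_ _∣_⊨_ _∣_⊩_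

  _∣_⊨ᴹ_ : Val → Team {Φ} F → ML Φ → Set₁
  V ∣ T ⊨ᴹ δ = _,_⊨ᴹ_ F V T δ

  _∣_⊨_ : Val → Team {Φ} F → EMDL Φ → Set₁
  V ∣ T ⊨ φ = _,_⊨_ F V T φ

  _∣_⊩_ : Val → W → ML Φ → Set
  V ∣ w ⊩ var p  = V p w
  V ∣ w ⊩ nvar p = ¬ V p w
  V ∣ w ⊩ δ ∧ ε  = V ∣ w ⊩ δ × V ∣ w ⊩ ε
  V ∣ w ⊩ δ ∨ ε  = V ∣ w ⊩ δ ⊎ V ∣ w ⊩ ε
  V ∣ w ⊩ ◇ δ    = Σ W λ v → R w v × V ∣ v ⊩ δ
  V ∣ w ⊩ □ δ    = ∀ v → R w v → V ∣ v ⊩ δ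

  ⊨ᴹ⇒⊩ : ∀ {V T} δ → V ∣ T ⊨ᴹ δ → ∀ w → T w → V ∣ w ⊩ δ
  ⊨ᴹ⇒⊩ (var p)  (lift T⊆V) = T⊆V
  ⊨ᴹ⇒⊩ (nvar p) (lift T∩V=∅) = T∩V=∅
  ⊨ᴹ⇒⊩ (δ ∧ ε) (Tδ , Tε) w w∈T = ⊨ᴹ⇒⊩ δ Tδ w w∈T , ⊨ᴹ⇒⊩ ε Tε w w∈T
  ⊨ᴹ⇒⊩ (δ ∨ ε) (T₁ , T₂ , (T⊆T₁∪T₂ , _) , T₁δ , T₂ε) w w∈T with T⊆T₁∪T₂ w w∈T
  ... | inj₁ w∈T₁ = inj₁ (⊨ᴹ⇒⊩ δ T₁δ w w∈T₁)
  ... | inj₂ w∈T₂ = inj₂ (⊨ᴹ⇒⊩ ε T₂ε w w∈T₂)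
  ⊨ᴹ⇒⊩ (◇ δ) (T′ , (forth , _) , T′δ) w w∈T =
    let (v , wRv , v∈T′) = forth w w∈T in v , wRv , ⊨ᴹ⇒⊩ δ T′δ v v∈T′
  ⊨ᴹ⇒⊩ (□ δ) RTδ w w∈T v wRv = ⊨ᴹ⇒⊩ δ RTδ v (w , w∈T , wRv)

  ⊩⇒⊨ᴹ : ∀ {V T} δ → (∀ w → T w → V ∣ w ⊩ δ) → V ∣ T ⊨ᴹ δ
  ⊩⇒⊨ᴹ (var p)  T⊩ = lift T⊩
  ⊩⇒⊨ᴹ (nvar p) T⊩ = lift T⊩
  ⊩⇒⊨ᴹ (δ ∧ ε) T⊩ = ⊩⇒⊨ᴹ δ (λ w → proj₁ ∘ T⊩ w) , ⊩⇒⊨ᴹ ε (λ w → proj₂ ∘ T⊩ w)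
  ⊩⇒⊨ᴹ {V} {T} (δ ∨ ε) T⊩ =
    (λ w → T w × V ∣ w ⊩ δ) , (λ w → T w × V ∣ w ⊩ ε) ,
    (cover , (λ _ → proj₁) , (λ _ → proj₁)) ,
    ⊩⇒⊨ᴹ δ (λ _ → proj₂) , ⊩⇒⊨ᴹ ε (λ _ → proj₂)
    where
    cover : ∀ w → T w → (T w × V ∣ w ⊩ δ) ⊎ (T w × V ∣ w ⊩ ε)
    cover w w∈T with T⊩ w w∈T
    ... | inj₁ wδ = inj₁ (w∈T , wδ)
    ... | inj₂ wε = inj₂ (w∈T , wε)
  ⊩⇒⊨ᴹ {V} {T} (◇ δ) T⊩ =
    (λ v → Σ W λ w → T w × R w v × V ∣ v ⊩ δ) ,
    ((λ w w∈T → let (v , wRv , vδ) = T⊩ w w∈T in v , wRv , w , w∈T , wRv , vδ) ,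
     (λ v (w , w∈T , wRv , _) → w , w∈T , wRv)) ,
    ⊩⇒⊨ᴹ δ (λ v (_ , _ , _ , vδ) → vδ)
  ⊩⇒⊨ᴹ (□ δ) T⊩ = ⊩⇒⊨ᴹ δ (λ v (w , w∈T , wRv) → T⊩ w w∈T v wRv)

  singleton-⊨ᴹ : ∀ {V} w δ → V ∣ ⟦_⟧ {Φ} F w ⊨ᴹ δ ⇔ V ∣ w ⊩ δ
  singleton-⊨ᴹ {V} w δ =
    mk⇔ (λ wδ → ⊨ᴹ⇒⊩ δ wδ w refl) (λ wδ → ⊩⇒⊨ᴹ δ (λ _ w≡v → subst (V ∣_⊩ δ) w≡v wδ))

  Agree⇔ : ∀ {V w v} δ → Agree F V w v δ ⇔ (V ∣ w ⊩ δ ⇔ V ∣ v ⊩ δ)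
  Agree⇔ {w = w} {v} δ = ⇔-cong (singleton-⊨ᴹ w δ) (singleton-⊨ᴹ v δ)

  ⊨-toEMDL⇒⊨ᴹ : ∀ {V T} δ → V ∣ T ⊨ toEMDL δ → V ∣ T ⊨ᴹ δ
  ⊨-toEMDL⇒⊨ᴹ (var p)  Tδ = Tδ
  ⊨-toEMDL⇒⊨ᴹ (nvar p) Tδ = Tδ
  ⊨-toEMDL⇒⊨ᴹ (δ ∧ ε) (Tδ , Tε) = ⊨-toEMDL⇒⊨ᴹ δ Tδ , ⊨-toEMDL⇒⊨ᴹ ε Tε
  ⊨-toEMDL⇒⊨ᴹ (δ ∨ ε) (T₁ , T₂ , T=T₁∪T₂ , T₁δ , T₂ε) =
    T₁ , T₂ , T=T₁∪T₂ , ⊨-toEMDL⇒⊨ᴹ δ T₁δ , ⊨-toEMDL⇒⊨ᴹ ε T₂ε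
  ⊨-toEMDL⇒⊨ᴹ (◇ δ) (T′ , TT′ , T′δ) = T′ , TT′ , ⊨-toEMDL⇒⊨ᴹ δ T′δ
  ⊨-toEMDL⇒⊨ᴹ (□ δ) RTδ = ⊨-toEMDL⇒⊨ᴹ δ RTδ

  ⊨ᴹ⇒⊨-toEMDL : ∀ {V T} δ → V ∣ T ⊨ᴹ δ → V ∣ T ⊨ toEMDL δ
  ⊨ᴹ⇒⊨-toEMDL (var p)  Tδ = Tδ
  ⊨ᴹ⇒⊨-toEMDL (nvar p) Tδ = Tδ
  ⊨ᴹ⇒⊨-toEMDL (δ ∧ ε) (Tδ , Tε) = ⊨ᴹ⇒⊨-toEMDL δ Tδ , ⊨ᴹ⇒⊨-toEMDL ε Tε
  ⊨ᴹ⇒⊨-toEMDL (δ ∨ ε) (T₁ , T₂ , T=T₁∪T₂ , T₁δ , T₂ε) =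
    T₁ , T₂ , T=T₁∪T₂ , ⊨ᴹ⇒⊨-toEMDL δ T₁δ , ⊨ᴹ⇒⊨-toEMDL ε T₂ε
  ⊨ᴹ⇒⊨-toEMDL (◇ δ) (T′ , TT′ , T′δ) = T′ , TT′ , ⊨ᴹ⇒⊨-toEMDL δ T′δ
  ⊨ᴹ⇒⊨-toEMDL (□ δ) RTδ = ⊨ᴹ⇒⊨-toEMDL δ RTδ

  AgreeOn : List Φ → Val → Val → Set
  AgreeOn ps V V′ = All (λ p → ∀ w → V p w ⇔ V′ p w) ps

  ⊩-cong : ∀ {V V′} δ → AgreeOn (varsᴹ δ) V V′ → ∀ w → V ∣ w ⊩ δ ⇔ V′ ∣ w ⊩ δ
  ⊩-cong (var p)  (V≈V′ ∷ []) w = V≈V′ w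
  ⊩-cong (nvar p) (V≈V′ ∷ []) w = ¬-cong-⇔ (V≈V′ w)
  ⊩-cong (δ ∧ ε) V≈V′ w =
    ⊩-cong δ (++⁻ˡ (varsᴹ δ) V≈V′) w ×-⇔ ⊩-cong ε (++⁻ʳ (varsᴹ δ) V≈V′) w
  ⊩-cong (δ ∨ ε) V≈V′ w =
    ⊩-cong δ (++⁻ˡ (varsᴹ δ) V≈V′) w ⊎-⇔ ⊩-cong ε (++⁻ʳ (varsᴹ δ) V≈V′) w
  ⊩-cong (◇ δ) V≈V′ w =
    mk⇔ (λ (v , wRv , vδ) → v , wRv , to (⊩-cong δ V≈V′ v) vδ)
        (λ (v , wRv , vδ) → v , wRv , from (⊩-cong δ V≈V′ v) vδ)
  ⊩-cong (□ δ) V≈V′ w =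
    mk⇔ (λ wδ v wRv → to (⊩-cong δ V≈V′ v) (wδ v wRv))
        (λ wδ v wRv → from (⊩-cong δ V≈V′ v) (wδ v wRv))

  ⊩-negate⇒¬⊩ : ∀ {V w} δ → V ∣ w ⊩ negate δ → ¬ V ∣ w ⊩ δ
  ⊩-negate⇒¬⊩ (var p)  ¬wp  wp = ¬wp wp
  ⊩-negate⇒¬⊩ (nvar p) wp   ¬wp = ¬wp wp
  ⊩-negate⇒¬⊩ (δ ∧ ε) (inj₁ w¬δ) (wδ , _) = ⊩-negate⇒¬⊩ δ w¬δ wδ
  ⊩-negate⇒¬⊩ (δ ∧ ε) (inj₂ w¬ε) (_ , wε) = ⊩-negate⇒¬⊩ ε w¬ε wε
  ⊩-negate⇒¬⊩ (δ ∨ ε) (w¬δ , _) (inj₁ wδ) = ⊩-negate⇒¬⊩ δ w¬δ wδ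
  ⊩-negate⇒¬⊩ (δ ∨ ε) (_ , w¬ε) (inj₂ wε) = ⊩-negate⇒¬⊩ ε w¬ε wε
  ⊩-negate⇒¬⊩ (◇ δ) w¬δ (v , wRv , vδ) = ⊩-negate⇒¬⊩ δ (w¬δ v wRv) vδ
  ⊩-negate⇒¬⊩ (□ δ) (v , wRv , v¬δ) wδ = ⊩-negate⇒¬⊩ δ v¬δ (wδ v wRv)

  ⊩-mismatch⇒¬⇔ : ∀ {V w} q δ → V ∣ w ⊩ mismatch q δ → ¬ (V q w ⇔ V ∣ w ⊩ δ)
  ⊩-mismatch⇒¬⇔ q δ (inj₁ (wq , w¬δ)) q⇔δ = ⊩-negate⇒¬⊩ δ w¬δ (to q⇔δ wq)
  ⊩-mismatch⇒¬⇔ q δ (inj₂ (¬wq , wδ)) q⇔δ = ¬wq (from q⇔δ wδ)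

  Labelled : Val → Val → (ℕ → Φ) → List (ML Φ) → W → Set
  Labelled V′ V s []       w = ⊤
  Labelled V′ V s (δ ∷ δs) w = (V′ (s 0) w ⇔ V ∣ w ⊩ δ) × Labelled V′ V (s ∘ suc) δs w

  Labelled-++ : ∀ {V′ V s w} δs {εs} → Labelled V′ V s (δs ++ εs) w →
                Labelled V′ V s δs w × Labelled V′ V (s ∘ (length δs +_)) εs w
  Labelled-++ []       lab          = tt , lab
  Labelled-++ (δ ∷ δs) (lab₀ , lab) = (lab₀ , proj₁ (Labelled-++ δs lab)) , proj₂ (Labelled-++ δs lab)

  Labelled-cong : ∀ {V′ V V″ s} δs → AgreeOn (concatMap varsᴹ δs) V V″ →
                  ∀ {w} → Labelled V′ V s δs w → Labelled V′ V″ s δs w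
  Labelled-cong δs V≈V″ = go δs (map⁻ (concat⁻ V≈V″))
    where
    go : ∀ {V′ V V″ s w} δs → All (λ δ → AgreeOn (varsᴹ δ) V V″) δs →
         Labelled V′ V s δs w → Labelled V′ V″ s δs w
    go []       []               tt           = tt
    go (δ ∷ δs) (V≈V″ ∷ V≈V″s) (lab₀ , lab) = ⊩-cong δ V≈V″ _ ⇔-∘ lab₀ , go δs V≈V″s lab

  ⊩-someMismatch⇒¬Labelled : ∀ {V w s} δ δs → V ∣ w ⊩ someMismatch s δ δs → ¬ Labelled V V s (δ ∷ δs) w
  ⊩-someMismatch⇒¬Labelled {s = s} δ [] wδ≠ (lab₀ , _) = ⊩-mismatch⇒¬⇔ (s 0) δ wδ≠ lab₀
  ⊩-someMismatch⇒¬Labelled {s = s} δ (ε ∷ εs) (inj₁ wδ≠) (lab₀ , _) = ⊩-mismatch⇒¬⇔ (s 0) δ wδ≠ lab₀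
  ⊩-someMismatch⇒¬Labelled δ (ε ∷ εs) (inj₂ wεs≠) (_ , lab) = ⊩-someMismatch⇒¬Labelled ε εs wεs≠ lab

  Agree-label : ∀ {V′ V w v q} δ → (V′ q w ⇔ V ∣ w ⊩ δ) → (V′ q v ⇔ V ∣ v ⊩ δ) →
                Agree F V′ w v (var q) ⇔ Agree F V w v δ
  Agree-label {V′} {V} {q = q} δ q⇔δ-at-w q⇔δ-at-v =
    ⇔-sym (Agree⇔ {V} δ) ⇔-∘ (⇔-cong q⇔δ-at-w q⇔δ-at-v ⇔-∘ Agree⇔ {V′} (var q))

  Agree-labels : ∀ {V′ V w v s} δs → Labelled V′ V s δs w → Labelled V′ V s δs v →
                 All (Agree F V′ w v) (labels s δs) ⇔ All (Agree F V w v) δs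
  Agree-labels [] _ _ = mk⇔ (λ _ → []) (λ _ → [])
  Agree-labels {V′} {s = s} (δ ∷ δs) (labw₀ , labw) (labv₀ , labv) =
    mk⇔ (λ { (a ∷ as) → to (Agree-label {V′} {q = s 0} δ labw₀ labv₀) a ∷ to (Agree-labels δs labw labv) as })
        (λ { (a ∷ as) → from (Agree-label {V′} {q = s 0} δ labw₀ labv₀) a ∷ from (Agree-labels δs labw labv) as })

  translate-complete : ∀ {V V′ T} φ s → AgreeOn (vars φ) V V′ →
                       (∀ w → Labelled V′ V s (depArgs φ) w) →
                       V′ ∣ T ⊨ translate φ s → V ∣ T ⊨ φ
  translate-complete (var p) s (V≈V′ ∷ []) _ (lift T⊆V′p) =
    lift λ w w∈T → from (V≈V′ w) (T⊆V′p w w∈T)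
  translate-complete (nvar p) s (V≈V′ ∷ []) _ (lift T∩V′p=∅) =
    lift λ w w∈T → T∩V′p=∅ w w∈T ∘ to (V≈V′ w)
  translate-complete (φ ∧ ψ) s V≈V′ lab (Tφ , Tψ) =
    translate-complete φ s (++⁻ˡ (vars φ) V≈V′) (proj₁ ∘ Labelled-++ (depArgs φ) ∘ lab) Tφ ,
    translate-complete ψ _ (++⁻ʳ (vars φ) V≈V′) (proj₂ ∘ Labelled-++ (depArgs φ) ∘ lab) Tψ
  translate-complete (φ ∨ ψ) s V≈V′ lab (T₁ , T₂ , T=T₁∪T₂ , T₁φ , T₂ψ) =
    T₁ , T₂ , T=T₁∪T₂ ,
    translate-complete φ s (++⁻ˡ (vars φ) V≈V′) (proj₁ ∘ Labelled-++ (depArgs φ) ∘ lab) T₁φ ,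
    translate-complete ψ _ (++⁻ʳ (vars φ) V≈V′) (proj₂ ∘ Labelled-++ (depArgs φ) ∘ lab) T₂ψ
  translate-complete (◇ φ) s V≈V′ lab (T′ , TT′ , T′φ) = T′ , TT′ , translate-complete φ s V≈V′ lab T′φ
  translate-complete (□ φ) s V≈V′ lab RTφ = translate-complete φ s V≈V′ lab RTφ
  translate-complete {V′ = V′} {T} (dep δs δ) s V≈V′ lab (T₁ , T₂ , (T⊆T₁∪T₂ , _) , T₁≠ , T₂dep)
                     w v w∈T v∈T agreeδs =
    to (Agree-label {V′} {q = s 0} δ (proj₁ (lab w)) (proj₁ (lab v)))
       (T₂dep w v (T⊆T₂ w w∈T) (T⊆T₂ v v∈T)
              (from (Agree-labels δs (proj₂ (lab w)) (proj₂ (lab v))) agreeδs))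
    where
    T₁-empty : ∀ u → ¬ T₁ u
    T₁-empty u u∈T₁ =
      ⊩-someMismatch⇒¬Labelled δ δs
        (⊨ᴹ⇒⊩ (someMismatch s δ δs) (⊨-toEMDL⇒⊨ᴹ (someMismatch s δ δs) T₁≠) u u∈T₁)
        (Labelled-cong {s = s} (δ ∷ δs) V≈V′ (lab u))

    T⊆T₂ : ∀ u → T u → T₂ u
    T⊆T₂ u u∈T with T⊆T₁∪T₂ u u∈T
    ... | inj₁ u∈T₁ = contradiction u∈T₁ (T₁-empty u)
    ... | inj₂ u∈T₂ = u∈T₂

module Classical {Φ : Set} (em : ExcludedMiddle 0ℓ) (F : Frame) where
  open Frame F
  open Syntax {Φ}
  open Semantics {Φ} F

  ¬⊩⇒⊩-negate : ∀ {V w} δ → ¬ V ∣ w ⊩ δ → V ∣ w ⊩ negate δ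
  ¬⊩⇒⊩-negate (var p) ¬wp = ¬wp
  ¬⊩⇒⊩-negate (nvar p) ¬¬wp = decidable-stable em ¬¬wp
  ¬⊩⇒⊩-negate {V} {w} (δ ∧ ε) ¬wδε with em {V ∣ w ⊩ δ}
  ... | yes wδ = inj₂ (¬⊩⇒⊩-negate ε (λ wε → ¬wδε (wδ , wε)))
  ... | no ¬wδ = inj₁ (¬⊩⇒⊩-negate δ ¬wδ)
  ¬⊩⇒⊩-negate (δ ∨ ε) ¬wδε = ¬⊩⇒⊩-negate δ (¬wδε ∘ inj₁) , ¬⊩⇒⊩-negate ε (¬wδε ∘ inj₂)
  ¬⊩⇒⊩-negate (◇ δ) ¬w◇δ v wRv = ¬⊩⇒⊩-negate δ (λ vδ → ¬w◇δ (v , wRv , vδ))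
  ¬⊩⇒⊩-negate {V} {w} (□ δ) ¬w□δ with em {Σ W λ v → R w v × ¬ V ∣ v ⊩ δ}
  ... | yes (v , wRv , ¬vδ) = v , wRv , ¬⊩⇒⊩-negate δ ¬vδ
  ... | no ∄v = contradiction (λ v wRv → decidable-stable em (λ ¬vδ → ∄v (v , wRv , ¬vδ))) ¬w□δ

  ¬⇔⇒⊩-mismatch : ∀ {V w} q δ → ¬ (V q w ⇔ V ∣ w ⊩ δ) → V ∣ w ⊩ mismatch q δ
  ¬⇔⇒⊩-mismatch {V} {w} q δ ¬q⇔δ with em {V q w}
  ... | yes wq = inj₁ (wq , ¬⊩⇒⊩-negate δ (λ wδ → ¬q⇔δ (mk⇔ (λ _ → wδ) (λ _ → wq))))
  ... | no ¬wq = inj₂ (¬wq , decidable-stable em (λ ¬wδ →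
                   ¬q⇔δ (mk⇔ (λ wq → contradiction wq ¬wq) (λ wδ → contradiction wδ ¬wδ))))

  ¬Labelled⇒⊩-someMismatch : ∀ {V w s} δ δs → ¬ Labelled V V s (δ ∷ δs) w → V ∣ w ⊩ someMismatch s δ δs
  ¬Labelled⇒⊩-someMismatch {s = s} δ [] ¬lab = ¬⇔⇒⊩-mismatch (s 0) δ (λ lab₀ → ¬lab (lab₀ , tt))
  ¬Labelled⇒⊩-someMismatch {V} {w} {s} δ (ε ∷ εs) ¬lab with em {V (s 0) w ⇔ V ∣ w ⊩ δ}
  ... | yes lab₀ = inj₂ (¬Labelled⇒⊩-someMismatch ε εs (λ lab → ¬lab (lab₀ , lab)))
  ... | no ¬lab₀ = inj₁ (¬⇔⇒⊩-mismatch (s 0) δ ¬lab₀)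

  translate-sound : ∀ {V T} φ s → V ∣ T ⊨ φ → V ∣ T ⊨ translate φ s
  translate-sound (var p)  s Tp = Tp
  translate-sound (nvar p) s T¬p = T¬p
  translate-sound (φ ∧ ψ) s (Tφ , Tψ) = translate-sound φ s Tφ , translate-sound ψ _ Tψ
  translate-sound (φ ∨ ψ) s (T₁ , T₂ , T=T₁∪T₂ , T₁φ , T₂ψ) =
    T₁ , T₂ , T=T₁∪T₂ , translate-sound φ s T₁φ , translate-sound ψ _ T₂ψ
  translate-sound (◇ φ) s (T′ , TT′ , T′φ) = T′ , TT′ , translate-sound φ s T′φ
  translate-sound (□ φ) s RTφ = translate-sound φ s RTφ
  translate-sound {V} {T} (dep δs δ) s Tdep =
    (λ w → T w × ¬ Lab w) , (λ w → T w × Lab w) , (cover , (λ _ → proj₁) , (λ _ → proj₁)) ,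
    ⊨ᴹ⇒⊨-toEMDL (someMismatch s δ δs)
      (⊩⇒⊨ᴹ (someMismatch s δ δs) (λ _ (_ , ¬lab) → ¬Labelled⇒⊩-someMismatch δ δs ¬lab)) ,
    λ w v (w∈T , labw₀ , labw) (v∈T , labv₀ , labv) agreeLabels →
      from (Agree-label {V} {q = s 0} δ labw₀ labv₀)
           (Tdep w v w∈T v∈T (to (Agree-labels δs labw labv) agreeLabels))
    where
    Lab : W → Set
    Lab = Labelled V V s (δ ∷ δs)

    cover : ∀ w → T w → (T w × ¬ Lab w) ⊎ (T w × Lab w)
    cover w w∈T with em {Lab w}
    ... | yes lab = inj₂ (w∈T , lab)
    ... | no ¬lab = inj₁ (w∈T , ¬lab)

module Labelling {Φ : Set} (F : Frame) (V : Valuation {Φ} F)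
                 (s : ℕ → Φ) (s-injective : Injective _≡_ _≡_ s) (δs : List (ML Φ)) where
  open import Data.Nat using (zero; suc)
  open Frame F
  open Semantics {Φ} F

  -- Indices past the end of the list satisfy nothing.
  ⊩-nth : List (ML Φ) → ℕ → W → Set
  ⊩-nth []       i       w = ⊥
  ⊩-nth (δ ∷ εs) zero    w = V ∣ w ⊩ δ
  ⊩-nth (δ ∷ εs) (suc i) w = ⊩-nth εs i w

  -- Φ has no decidable equality, so whether p is a label s i is split into two conditions.
  labelling : Valuation {Φ} F
  labelling p w = (∀ i → s i ≡ p → ⊩-nth δs i w) × ((∀ i → s i ≢ p) → V p w)

  labelling-label : ∀ i w → labelling (s i) w ⇔ ⊩-nth δs i w
  labelling-label i w =
    mk⇔ (λ (named , _) → named i refl)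
        (λ wδᵢ → (λ j sj≡si → subst (λ k → ⊩-nth δs k w) (sym (s-injective sj≡si)) wδᵢ) ,
                 (λ unlabelled → contradiction refl (unlabelled i)))

  labelling-unlabelled : ∀ {p} → (∀ i → s i ≢ p) → ∀ w → labelling p w ⇔ V p w
  labelling-unlabelled p∉s w =
    mk⇔ (λ (_ , wp) → wp p∉s) (λ wp → (λ i si≡p → contradiction si≡p (p∉s i)) , (λ _ → wp))

  agreeOn-labelling : ∀ ps → (∀ i → s i ∉ ps) → AgreeOn ps V labelling
  agreeOn-labelling ps s∉ps =
    tabulate λ p∈ps → ⇔-sym ∘ labelling-unlabelled (λ i si≡p → s∉ps i (subst (_∈ ps) (sym si≡p) p∈ps))

  Labelled-labelling : ∀ w → Labelled labelling V s δs w
  Labelled-labelling w = go δs (λ i → labelling-label i w)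
    where
    go : ∀ {s′} εs → (∀ i → labelling (s′ i) w ⇔ ⊩-nth εs i w) → Labelled labelling V s′ εs w
    go []       _       = tt
    go (ε ∷ εs) labelᵢ = labelᵢ 0 , go εs (labelᵢ ∘ suc)

-- ℕ's constructors are opened only inside the modules above, leaving suc and zero to Level here.
open import Level using (suc; zero)

lower-excludedMiddle : ExcludedMiddle (suc zero) → ExcludedMiddle 0ℓ
lower-excludedMiddle em = map′ lower lift em

open Syntax using (translate; isMDL-translate; vars; depArgs)

propositionC1 : ExcludedMiddle (suc zero) →
    (Φ : Set) → Infinite Φ →
    (φ : EMDL Φ) → Σ (EMDL Φ) λ φ* → IsMDL φ* ×
    ((F : Frame) → (F ⊨F φ) ⇔ (F ⊨F φ*))
propositionC1 em Φ inf φ with fresh-sequence inf (vars φ)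
... | s , s-injective , s∉φ = translate φ s , isMDL-translate φ s , λ F → mk⇔ (sound F) (complete F)
  where
  sound : ∀ F → F ⊨F φ → F ⊨F translate φ s
  sound F F⊨φ V T = translate-sound φ s (F⊨φ V T)
    where open Classical (lower-excludedMiddle em) F

  complete : ∀ F → F ⊨F translate φ s → F ⊨F φ
  complete F F⊨φ* V T =
    translate-complete φ s (agreeOn-labelling (vars φ) s∉φ) Labelled-labelling (F⊨φ* labelling T)
    where
    open Semantics F
    open Labelling F V s s-injective (depArgs φ)
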